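{- Let $n \geq 5$ be an integer and let $f$ be a $\gamma_R$-function of $P(n,2)$, with $V_i = \{v \in V(P(n,2)) : f(v) = i\}$ for $i = 0,1,2$. If $w_1 \in V_2$ and $w_2$ is a neighbor of $w_1$, then $w_2 \notin V_1$.
   Context: For integers $n$ and $k$, the generalized Petersen graph $P(n,k)$ is the graph with vertex set $\{v_i, u_i : 0 \leq i \leq n-1\}$ and edge set $\{v_i v_{i+1}, v_i u_i, u_i u_{i+k} : 0 \leq i \leq n-1\}$, subscripts taken modulo $n$. A Roman domination function (RDF) on a graph $G$ is a function $f: V(G) \to \{0,1,2\}$ such that every vertex $u$ with $f(u)=0$ is adjacent to at least one vertex $v$ with $f(v)=2$. Its weight is $\sum_{u \in V(G)} f(u)$. The Roman domination number $\gamma_R(G)$ is the minimum weight of an RDF on $G$, and a $\gamma_R$-function is an RDF of weight $\gamma_R(G)$. -}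

module Defs where

open import Data.Nat using (ℕ; _+_; _%_; _≤_; NonZero)
open import Data.Fin using (Fin; toℕ)
open import Data.Bool using (Bool; true; false)
open import Data.Product using (_×_; _,_)
open import Data.Sum using (_⊎_)
open import Data.List using (List; map; allFin; cartesianProduct)
open import Data.Nat.ListAction using (sum)
open import Relation.Binary.PropositionalEquality using (_≡_)

-- Vertices of the generalized Petersen graph P(n,k):
-- (false , i) stands for v_i (outer cycle), (true , i) stands for u_i (inner).
Vertex : ℕ → Set
Vertex n = Bool × Fin n

Shift : (n : ℕ) .{{_ : NonZero n}} → Fin n → ℕ → Fin n → Set
Shift n i a j = (toℕ i + a) % n ≡ toℕ j

data Edge (n k : ℕ) .{{_ : NonZero n}} : Vertex n → Vertex n → Set where
  outer : ∀ i j → Shift n i 1 j → Edge n k (false , i) (false , j)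
  spoke : ∀ i → Edge n k (false , i) (true , i)
  inner : ∀ i j → Shift n i k j → Edge n k (true , i) (true , j)

Adj : (n k : ℕ) .{{_ : NonZero n}} → Vertex n → Vertex n → Set
Adj n k x y = Edge n k x y ⊎ Edge n k y x

vertices : (n : ℕ) → List (Vertex n)
vertices n = cartesianProduct (false Data.List.∷ true Data.List.∷ Data.List.[]) (allFin n)

record Labelling (n : ℕ) : Set where
  field
    val    : Vertex n → ℕ
    val≤2  : ∀ x → val x ≤ 2
open Labelling public

IsRDF : (n k : ℕ) .{{_ : NonZero n}} → Labelling n → Set
IsRDF n k f = ∀ x → val f x ≡ 0 → Σ' x
  where
  open import Data.Product using (∃)
  Σ' : Vertex n → Set
  Σ' x = ∃ λ y → Adj n k x y × val f y ≡ 2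

weight : {n : ℕ} → Labelling n → ℕ
weight {n} f = sum (map (val f) (vertices n))

IsγRFunction : (n k : ℕ) .{{_ : NonZero n}} → Labelling n → Set
IsγRFunction n k f = IsRDF n k f × (∀ g → IsRDF n k g → weight f ≤ weight g)

≥5⇒NonZero : {n : ℕ} → 5 Data.Nat.≤ n → NonZero n
≥5⇒NonZero (Data.Nat.s≤s _) = _

-- Lowering a 1 to a 0 at a neighbour w of a vertex labelled 2 keeps the function
-- Roman dominating (w is now dominated by that neighbour, and no vertex labelled 2
-- was touched), but decreases the weight; this contradicts minimality.
module Submission where

open import Defs
open import Data.Nat using (ℕ; _≤_; _<_; NonZero; z≤n; s≤s)
open import Data.Nat.Properties using (≤-refl; +-mono-≤; +-mono-<-≤; +-mono-≤-<; <⇒≱)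
open import Data.Bool using (true; false)
import Data.Bool.Properties as Bool
import Data.Fin.Properties as Fin
open import Data.Empty using (⊥-elim)
open import Data.Product using (∃; _×_; _,_)
open import Data.Product.Properties using (≡-dec)
open import Data.Sum using (swap)
open import Data.List using (List; []; _∷_; map)
open import Data.Nat.ListAction using (sum)
open import Data.List.Membership.Propositional using (_∈_)
open import Data.List.Relation.Unary.Any using (here; there)
open import Data.List.Membership.Propositional.Properties using (∈-cartesianProduct⁺; ∈-allFin)
open import Relation.Binary.Definitions using (DecidableEquality)
open import Relation.Binary.PropositionalEquality using (_≡_; _≢_; refl; sym; trans; subst)
open import Relation.Nullary using (¬_; Dec; yes; no)

sum-map-mono-≤ : {A : Set} {g h : A → ℕ} → (∀ x → g x ≤ h x) → (xs : List A) →
  sum (map g xs) ≤ sum (map h xs)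
sum-map-mono-≤ g≤h []       = z≤n
sum-map-mono-≤ g≤h (x ∷ xs) = +-mono-≤ (g≤h x) (sum-map-mono-≤ g≤h xs)

sum-map-mono-< : {A : Set} {g h : A → ℕ} → (∀ x → g x ≤ h x) →
  {w : A} → g w < h w → {xs : List A} → w ∈ xs → sum (map g xs) < sum (map h xs)
sum-map-mono-< g≤h gw<hw {xs = _ ∷ xs} (here refl) = +-mono-<-≤ gw<hw (sum-map-mono-≤ g≤h xs)
sum-map-mono-< g≤h gw<hw {xs = x ∷ _} (there w∈xs) = +-mono-≤-< (g≤h x) (sum-map-mono-< g≤h gw<hw w∈xs)

module _ {n : ℕ} where

  _≟ᵥ_ : DecidableEquality (Vertex n)
  _≟ᵥ_ = ≡-dec Bool._≟_ Fin._≟_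

  ∈-vertices : (x : Vertex n) → x ∈ vertices n
  ∈-vertices (b , i) = ∈-cartesianProduct⁺ {xs = false ∷ true ∷ []} (∈-bools b) (∈-allFin i)
    where
    ∈-bools : ∀ b → b ∈ false ∷ true ∷ []
    ∈-bools false = here refl
    ∈-bools true  = there (here refl)

  erase : Labelling n → Vertex n → Labelling n
  val (erase f w) x with x ≟ᵥ w
  ... | yes _ = 0
  ... | no  _ = val f x
  val≤2 (erase f w) x with x ≟ᵥ w
  ... | yes _ = z≤n
  ... | no  _ = val≤2 f x

  module _ (f : Labelling n) (w : Vertex n) where

    val-erase-≤ : ∀ x → val (erase f w) x ≤ val f x
    val-erase-≤ x with x ≟ᵥ w
    ... | yes _ = z≤n
    ... | no  _ = ≤-refl

    val-erase-≡ : ∀ {x} → x ≢ w → val (erase f w) x ≡ val f x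
    val-erase-≡ {x} x≢w with x ≟ᵥ w
    ... | yes x≡w = ⊥-elim (x≢w x≡w)
    ... | no  _   = refl

    val-erase-self : val (erase f w) w ≡ 0
    val-erase-self with w ≟ᵥ w
    ... | yes _   = refl
    ... | no  w≢w = ⊥-elim (w≢w refl)

    weight-erase-< : 0 < val f w → weight (erase f w) < weight f
    weight-erase-< 0<fw =
      sum-map-mono-< val-erase-≤ (subst (_< val f w) (sym val-erase-self) 0<fw) (∈-vertices w)

    erase-isRDF : (k : ℕ) .{{_ : NonZero n}} → IsRDF n k f → val f w ≢ 2 →
      ∃ (λ y → Adj n k w y × val f y ≡ 2) → IsRDF n k (erase f w)
    erase-isRDF k rdf fw≢2 (y , w~y , fy≡2) x = dominated (x ≟ᵥ w)
      where
      ≢w : ∀ {z} → val f z ≡ 2 → z ≢ w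
      ≢w fz≡2 refl = fw≢2 fz≡2

      dominated : Dec (x ≡ w) → val (erase f w) x ≡ 0 →
        ∃ (λ z → Adj n k x z × val (erase f w) z ≡ 2)
      dominated (yes refl) _ = y , w~y , trans (val-erase-≡ (≢w fy≡2)) fy≡2
      dominated (no x≢w) ex≡0 with rdf x (trans (sym (val-erase-≡ x≢w)) ex≡0)
      ... | z , x~z , fz≡2 = z , x~z , trans (val-erase-≡ (≢w fz≡2)) fz≡2

lemma2p2 : (n : ℕ) → (n≥5 : 5 ≤ n) → (f : Labelling n) →
    IsγRFunction n 2 {{≥5⇒NonZero n≥5}} f →
    (w₁ w₂ : Vertex n) → val f w₁ ≡ 2 → Adj n 2 {{≥5⇒NonZero n≥5}} w₁ w₂ → ¬ (val f w₂ ≡ 1)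
lemma2p2 n n≥5 f (rdf , minimal) w₁ w₂ fw₁≡2 w₁~w₂ fw₂≡1 =
  <⇒≱ (weight-erase-< f w₂ (subst (0 <_) (sym fw₂≡1) (s≤s z≤n)))
      (minimal (erase f w₂) (erase-isRDF f w₂ 2 rdf fw₂≢2 (w₁ , swap w₁~w₂ , fw₁≡2)))
  where
  instance _ = ≥5⇒NonZero n≥5
  fw₂≢2 : val f w₂ ≢ 2
  fw₂≢2 fw₂≡2 with trans (sym fw₂≡2) fw₂≡1
  ... | ()
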